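{- Let $m \ge 1$ and $n \ge 2$, and let $B_n^{(m)}$, $T_n^{(m)}$ be the block and terminating string defined in the context. Then (a) $T_n^{(m)}$ is a suffix of $B_n^{(m)}$, and (b) this is the only occurrence of $T_n^{(m)}$ as a substring of $B_n^{(m)}$.
   Context: Strings may be finite or infinite; for a finite nonempty $U$ and any $V$, $UV$ denotes concatenation; $l(U)$ is the length (possibly $\infty$). For a nonempty finite string $U$ of positive integers, $\mathcal{C}(U)$ is the largest integer $k\ge1$ with $U = XY^k$ for strings $X,Y$, $Y$ nonempty; $\mathcal{C}^{(m)}(U)=\max\{m,\mathcal{C}(U)\}$. Fix $m\ge1$. Define blocks $B_n^{(m)}$ and glue strings $S_n^{(m)}$ recursively: $B_1^{(m)} = m$ (a string of length 1). For $n\ge1$: if $B_n^{(m)}$ is infinite, set $B_{n+1}^{(m)} = B_n^{(m)}$ and $S_i^{(m)} = \emptyset$ for all $i \ge n$. If $B_n^{(m)}$ is finite, define $s(1) = \mathcal{C}^{(m)}((B_n^{(m)})^{m+1})$ and $s(i+1) = \mathcal{C}^{(m)}((B_n^{(m)})^{m+1} s(1)\ldots s(i))$ for $i\ge1$; if some $i\ge1$ has $s(i+1) < m+1$, take the least such $i$ and set $S_n^{(m)} = s(1),\ldots,s(i)$; otherwise set $S_n^{(m)} = s(1), s(2), \ldots$ (an infinite string); then $B_{n+1}^{(m)} = (B_n^{(m)})^{m+1} S_n^{(m)}$. The strings $T_n^{(m)}$ ($n\ge2$) are: if $S_1^{(m)},\ldots,S_{n-1}^{(m)}$ are finite, $T_{n+1}^{(m)}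 = S_1^{(m)}\cdots S_n^{(m)}$; if $S_1^{(m)},\ldots,S_{n-1}^{(m)}$ are finite but $S_n^{(m)}$ is infinite, $T_{n+1}^{(m)} = S_1^{(m)}\cdots S_n^{(m)}$ (infinite) and $T_i^{(m)} = T_{n+1}^{(m)}$ for all $i \ge n+2$. A string $V$ is a suffix of $W$ if $W = UV$ for some finite string $U$; $V$ occurs as a substring of $W$ if the entries of $V$ appear consecutively in $W$. -}

module Defs where

open import Data.Nat using (ℕ; zero; suc; _+_; _≤_; _<_; _⊔_)
open import Data.List using (List; []; _∷_; _++_; concat; replicate; map; upTo; length)
open import Data.Maybe using (Maybe; just; nothing)
open import Data.Product using (Σ; _×_; ∃)
open import Relation.Binary.PropositionalEquality using (_≡_; _≢_)

data Str : Set where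
  fin : List ℕ → Str
  inf : (ℕ → ℕ) → Str

nth : List ℕ → ℕ → Maybe ℕ
nth []       _       = nothing
nth (x ∷ xs) zero    = just x
nth (x ∷ xs) (suc i) = nth xs i

at : Str → ℕ → Maybe ℕ
at (fin xs) i = nth xs i
at (inf f)  i = just (f i)

_≈ˢ_ : Str → Str → Set
V ≈ˢ W = ∀ i → at V i ≡ at W i

_++ᶠ_ : List ℕ → (ℕ → ℕ) → (ℕ → ℕ)
([]     ++ᶠ f) i       = f i
((x ∷ xs) ++ᶠ f) zero    = x
((x ∷ xs) ++ᶠ f) (suc i) = (xs ++ᶠ f) i

_++ˢ_ : List ℕ → Str → Str
U ++ˢ fin V = fin (U ++ V)
U ++ˢ inf f = inf (U ++ᶠ f)

OccursAt : Str → Str → ℕ → Set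
OccursAt V W p = ∀ j x → at V j ≡ just x → at W (p + j) ≡ just x

rep : ℕ → List ℕ → List ℕ
rep k Y = concat (replicate k Y)

prefix : (ℕ → ℕ) → ℕ → List ℕ
prefix s i = map s (upTo i)

HasTail : List ℕ → ℕ → Set
HasTail U k = Σ (List ℕ) λ X → Σ (List ℕ) λ Y → (Y ≢ []) × (U ≡ X ++ rep k Y)

IsCurling : List ℕ → ℕ → Set
IsCurling U k = (1 ≤ k) × HasTail U k × (∀ k′ → 1 ≤ k′ → HasTail U k′ → k′ ≤ k)

IsCurlingᵐ : ℕ → List ℕ → ℕ → Set
IsCurlingᵐ m U k = Σ ℕ λ c → IsCurling U c × (k ≡ m ⊔ c)

-- Glue strings.  The sequence s(1), s(2), … of the paper is s 0, s 1, …

IsSeq : ℕ → List ℕ → (ℕ → ℕ) → Set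
IsSeq m B s = ∀ i → IsCurlingᵐ m (rep (suc m) B ++ prefix s i) (s i)

GlueFin : ℕ → List ℕ → List ℕ → Set
GlueFin m B S = Σ (ℕ → ℕ) λ s → Σ ℕ λ i →
  IsSeq m B s × (1 ≤ i) × (s i < suc m)
  × (∀ j → 1 ≤ j → j < i → suc m ≤ s j) × (S ≡ prefix s i)

GlueInf : ℕ → List ℕ → (ℕ → ℕ) → Set
GlueInf m B s = IsSeq m B s × (∀ j → 1 ≤ j → suc m ≤ s j)

-- Stage m n B T  :  B = B_n^(m)  and  T = T_n^(m)  (for n ≥ 2;
-- at n = 1, T is the empty accumulator so that T_{n+1} = T_n S_n).

data Stage (m : ℕ) : ℕ → Str → Str → Set where
  base     : Stage m 1 (fin (m ∷ [])) (fin [])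
  step-fin : ∀ {n B T S} → Stage m n (fin B) (fin T) → GlueFin m B S →
             Stage m (suc n) (fin (rep (suc m) B ++ S)) (fin (T ++ S))
  step-inf : ∀ {n B T s} → Stage m n (fin B) (fin T) → GlueInf m B s →
             Stage m (suc n) (inf (rep (suc m) B ++ᶠ s)) (inf (T ++ᶠ s))
  stay-inf : ∀ {n b t} → Stage m n (inf b) (inf t) →
             Stage m (suc n) (inf b) (inf t)

-- Finite stages, by induction on n: B_n begins with m, every entry of T_n exceeds m,
-- and T_n occurs in B_n only as its suffix. In B_{n+1} = B_n^{m+1} S_n an occurrence
-- of T_n S_n cannot cover the leading m of a copy of B_n, so it sits inside one copy
-- of B_n (followed by S_n if it is the last copy); uniqueness in B_n places T_n at the
-- end of that copy, and S_n, being nonempty, forces the copy to be the last one.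
-- Infinite stages: two occurrences of the infinite T_n at different offsets make B_n,
-- hence its glue string S, periodic from some point a with some period d. For every k the
-- word B^{m+1} S(0) … S(a + k d - 1), whose curling number is recorded as S(a + k d), then
-- ends in Y^k with Y the period block, so S(a + k d) ≥ k; but S(a + k d) = S(a), which
-- fails for k = 1 + S(a).
module Submission where

open import Defs
open import Data.Nat using (ℕ; zero; suc; _+_; _*_; _≤_; _<_; z≤n; s≤s; _≤?_)
open import Data.Nat.Properties
open import Algebra.Properties.CommutativeSemigroup +-commutativeSemigroup using (x∙yz≈y∙xz)
open import Data.List using (List; []; _∷_; _++_; length; map; upTo; applyUpTo)
open import Data.List.Properties using (length-++; ++-assoc; ++-identityʳ; map-upTo; length-map; length-upTo)
open import Data.List.Relation.Unary.All using (All; []; _∷_)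
open import Data.List.Relation.Unary.All.Properties using (++⁺; applyUpTo⁺₁)
open import Data.Maybe using (just)
open import Data.Maybe.Properties using (just-injective)
open import Data.Product using (Σ; _×_; _,_)
open import Data.Sum using (inj₁; inj₂)
open import Data.Empty using (⊥-elim)
open import Relation.Nullary using (¬_; yes; no)
open import Relation.Binary using (tri<; tri≈; tri>)
open import Relation.Binary.PropositionalEquality
open ≡-Reasoning

nth-++ˡ : ∀ xs ys j → j < length xs → nth (xs ++ ys) j ≡ nth xs j
nth-++ˡ (x ∷ xs) ys zero    _         = refl
nth-++ˡ (x ∷ xs) ys (suc j) (s≤s j<n) = nth-++ˡ xs ys j j<n

nth-++ʳ : ∀ xs ys j → nth (xs ++ ys) (length xs + j) ≡ nth ys j
nth-++ʳ []       ys j = refl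
nth-++ʳ (x ∷ xs) ys j = nth-++ʳ xs ys j

nth-just⇒< : ∀ xs j {x} → nth xs j ≡ just x → j < length xs
nth-just⇒< (x ∷ xs) zero    _ = s≤s z≤n
nth-just⇒< (x ∷ xs) (suc j) e = s≤s (nth-just⇒< xs j e)

nth-just-++ˡ : ∀ xs ys {j x} → nth xs j ≡ just x → nth (xs ++ ys) j ≡ just x
nth-just-++ˡ xs ys {j} e = trans (nth-++ˡ xs ys j (nth-just⇒< xs j e)) e

<⇒nth-just : ∀ xs j → j < length xs → Σ ℕ λ x → nth xs j ≡ just x
<⇒nth-just (x ∷ xs) zero    _         = x , refl
<⇒nth-just (x ∷ xs) (suc j) (s≤s j<n) = <⇒nth-just xs j j<n

nth-All : ∀ {P : ℕ → Set} xs j {x} → All P xs → nth xs j ≡ just x → P x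
nth-All (x ∷ xs) zero    (px ∷ _)  refl = px
nth-All (x ∷ xs) (suc j) (_ ∷ pxs) e    = nth-All xs j pxs e

nth-just⇒≢[] : ∀ {xs j x} → nth xs j ≡ just x → xs ≢ []
nth-just⇒≢[] {x ∷ xs} _ ()

rep-suc : ∀ k (B : List ℕ) → rep (suc k) B ≡ rep k B ++ B
rep-suc zero    B = ++-identityʳ B
rep-suc (suc k) B = trans (cong (B ++_) (rep-suc k B)) (sym (++-assoc B (rep k B) B))

length-rep : ∀ k (B : List ℕ) → length (rep k B) ≡ k * length B
length-rep zero    B = refl
length-rep (suc k) B = trans (length-++ B) (cong (length B +_) (length-rep k B))

rep-suc-split : ∀ k {B U T : List ℕ} → B ≡ U ++ T → rep (suc k) B ≡ (rep k B ++ U) ++ T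
rep-suc-split k {B} {U} {T} refl = trans (rep-suc k B) (sym (++-assoc (rep k B) U T))

occursAt-fits : ∀ X W p → 0 < length X → OccursAt (fin X) (fin W) p → p + length X ≤ length W
occursAt-fits (x ∷ X) W p _ occ with <⇒nth-just (x ∷ X) (length X) ≤-refl
... | y , e = subst (_≤ length W) (sym (+-suc p (length X)))
                (nth-just⇒< W (p + length X) (occ (length X) y e))

occursAt-++ʳ : ∀ X xs ys q → OccursAt (fin X) (fin (xs ++ ys)) (length xs + q) → OccursAt (fin X) (fin ys) q
occursAt-++ʳ X xs ys q occ j x e = begin
  nth ys (q + j)                       ≡⟨ nth-++ʳ xs ys (q + j) ⟨
  nth (xs ++ ys) (length xs + (q + j)) ≡⟨ cong (nth (xs ++ ys)) (+-assoc (length xs) q j) ⟨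
  nth (xs ++ ys) (length xs + q + j)   ≡⟨ occ j x e ⟩
  just x                               ∎

occursAt-++ˡ : ∀ X xs ys p → OccursAt (fin X) (fin (xs ++ ys)) p → p + length X ≤ length xs →
               OccursAt (fin X) (fin xs) p
occursAt-++ˡ X xs ys p occ fit j x e =
  trans (sym (nth-++ˡ xs ys (p + j) (≤-trans (+-monoʳ-< p (nth-just⇒< X j e)) fit))) (occ j x e)

occursAt-prefix : ∀ X Y W p → OccursAt (fin (X ++ Y)) W p → OccursAt (fin X) W p
occursAt-prefix X Y W p occ j x e = occ j x (nth-just-++ˡ X Y e)

occursAt-before-marker : ∀ {m} X W p q → All (m <_) X → OccursAt (fin X) (fin W) p →
                         nth W q ≡ just m → p ≤ q → p + length X ≤ q
occursAt-before-marker X W p q above occ marker p≤q with p + length X ≤? q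
... | yes fit = fit
... | no ¬fit with m≤n⇒∃[o]m+o≡n p≤q
...   | j , refl with <⇒nth-just X j (+-cancelˡ-< p j (length X) (≰⇒> ¬fit))
...     | x , e = ⊥-elim (<-irrefl (just-injective (trans (sym marker) (occ j x e)))
                                   (nth-All X j above e))

tail≤curlingᵐ : ∀ {m U c k} → IsCurlingᵐ m U c → 1 ≤ k → HasTail U k → k ≤ c
tail≤curlingᵐ {m} (c , (_ , _ , maximal) , refl) 1≤k tail = ≤-trans (maximal _ 1≤k tail) (m≤n⊔m m c)

glue-head : ∀ {m B s} → B ≢ [] → IsSeq m B s → m < s 0
glue-head {m} {B} B≢[] seq =
  tail≤curlingᵐ (seq 0) (s≤s z≤n) ([] , B , B≢[] , ++-identityʳ (rep (suc m) B))

glueFin-above : ∀ {m B S} → B ≢ [] → GlueFin m B S → All (m <_) S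
glueFin-above {m} B≢[] (s , i , seq , _ , _ , later , refl) =
  subst (All (m <_)) (sym (map-upTo s i)) (applyUpTo⁺₁ s i above)
  where
  above : ∀ {j} → j < i → m < s j
  above {zero}  _   = glue-head B≢[] seq
  above {suc j} j<i = later (suc j) (s≤s z≤n) j<i

glueFin-nonempty : ∀ {m B S} → GlueFin m B S → 0 < length S
glueFin-nonempty (s , i , _ , 1≤i , _ , _ , refl) =
  subst (0 <_) (sym (trans (length-map s (upTo i)) (length-upTo i))) 1≤i

UniqueSuffix : Str → Str → Set
UniqueSuffix B T = Σ (List ℕ) λ U → (B ≈ˢ (U ++ˢ T)) × (∀ p → OccursAt T B p → p ≡ length U)

-- The restrictions 1 ≤ p and p + length T ≤ length B in unique only matter at the first
-- stage, where T is empty and so occurs at every position.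
record FinInv (m : ℕ) (B T : List ℕ) : Set where
  field
    U      : List ℕ
    split  : B ≡ U ++ T
    head   : nth B 0 ≡ just m
    above  : All (m <_) T
    unique : ∀ p → 1 ≤ p → OccursAt (fin T) (fin B) p → p + length T ≤ length B → p ≡ length U

module FinStep {m B T S} (inv : FinInv m B T) (glue : GlueFin m B S) where
  open FinInv inv

  S-above : All (m <_) S
  S-above = glueFin-above (nth-just⇒≢[] head) glue

  S-nonempty : 0 < length S
  S-nonempty = glueFin-nonempty glue

  L : ℕ
  L = length B

  TS-above : All (m <_) (T ++ S)
  TS-above = ++⁺ above S-above

  TS-nonempty : 0 < length (T ++ S)
  TS-nonempty = subst (0 <_) (sym (length-++ T)) (≤-trans S-nonempty (m≤n+m (length S) (length T)))

  length-TS : ∀ p → p + length (T ++ S) ≡ p + length T + length S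
  length-TS p = trans (cong (p +_) (length-++ T)) (sym (+-assoc p (length T) (length S)))

  T-ends-block : ∀ {W} p → 1 ≤ p → OccursAt (fin (T ++ S)) (fin (B ++ W)) p → p + length T ≤ L →
                 p + length T ≡ L
  T-ends-block {W} p 1≤p occ fit = begin
    p + length T         ≡⟨ cong (_+ length T) (unique p 1≤p T-occurs fit) ⟩
    length U + length T  ≡⟨ length-++ U ⟨
    length (U ++ T)      ≡⟨ cong length split ⟨
    L                    ∎
    where
    T-occurs : OccursAt (fin T) (fin B) p
    T-occurs = occursAt-++ˡ T B W p (occursAt-prefix T S (fin (B ++ W)) p occ) fit

  not-at-start : ∀ {W} → ¬ OccursAt (fin (T ++ S)) (fin (B ++ W)) 0
  not-at-start {W} occ = n≮n 0 (<-≤-trans TS-nonempty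
    (occursAt-before-marker (T ++ S) (B ++ W) 0 0 TS-above occ (nth-just-++ˡ B W head) z≤n))

  power-occurrence : ∀ k p → OccursAt (fin (T ++ S)) (fin (rep k B ++ S)) p → p + length T ≡ k * L
  block-occurrence : ∀ k p → OccursAt (fin (T ++ S)) (fin (B ++ (rep k B ++ S))) p → p + length T ≡ suc k * L

  power-occurrence zero p occ = n≤0⇒n≡0 (+-cancelʳ-≤ (length S) (p + length T) 0
    (subst (_≤ length S) (length-TS p) (occursAt-fits (T ++ S) S p TS-nonempty occ)))
  power-occurrence (suc k) p occ =
    block-occurrence k p (subst (λ Z → OccursAt (fin (T ++ S)) (fin Z) p) (++-assoc B (rep k B) S) occ)

  block-occurrence k p occ with <-≤-connex p L
  ... | inj₂ L≤p with m≤n⇒∃[o]m+o≡n L≤p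
  ...   | q , refl = begin
    L + q + length T    ≡⟨ +-assoc L q (length T) ⟩
    L + (q + length T)  ≡⟨ cong (L +_) (power-occurrence k q
                             (occursAt-++ʳ (T ++ S) B (rep k B ++ S) q occ)) ⟩
    L + k * L           ∎
  block-occurrence k zero occ | inj₁ _ = ⊥-elim (not-at-start occ)
  block-occurrence zero (suc p) occ | inj₁ _ =
    trans (T-ends-block (suc p) (s≤s z≤n) occ fit) (sym (+-identityʳ L))
    where
    fit : suc p + length T ≤ L
    fit = +-cancelʳ-≤ (length S) _ _ (subst₂ _≤_ (length-TS (suc p)) (length-++ B)
            (occursAt-fits (T ++ S) (B ++ S) (suc p) TS-nonempty occ))
  -- Some copy of B follows, and its leading m cannot be covered by the occurrence.
  block-occurrence (suc k) (suc p) occ | inj₁ p<L =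
    ⊥-elim (m+n≮m L 0 (<-≤-trans (+-monoʳ-< L S-nonempty) S-absent))
    where
    W : List ℕ
    W = rep (suc k) B ++ S
    marker : nth (B ++ W) L ≡ just m
    marker = begin
      nth (B ++ W) L        ≡⟨ cong (nth (B ++ W)) (+-identityʳ L) ⟨
      nth (B ++ W) (L + 0)  ≡⟨ nth-++ʳ B W 0 ⟩
      nth W 0               ≡⟨ nth-just-++ˡ (rep (suc k) B) S (nth-just-++ˡ B (rep k B) head) ⟩
      just m                ∎
    before : suc p + length T + length S ≤ L
    before = subst (_≤ L) (length-TS (suc p))
      (occursAt-before-marker (T ++ S) (B ++ W) (suc p) L TS-above occ marker (<⇒≤ p<L))
    S-absent : L + length S ≤ L
    S-absent = subst (λ x → x + length S ≤ L)
      (T-ends-block (suc p) (s≤s z≤n) occ (m+n≤o⇒m≤o (suc p + length T) before)) before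

  U′ : List ℕ
  U′ = rep m B ++ U

  next-split : rep (suc m) B ++ S ≡ U′ ++ (T ++ S)
  next-split = trans (cong (_++ S) (rep-suc-split m split)) (++-assoc U′ T S)

  next-unique : ∀ p → OccursAt (fin (T ++ S)) (fin (rep (suc m) B ++ S)) p → p ≡ length U′
  next-unique p occ = +-cancelʳ-≡ (length T) p (length U′) (begin
    p + length T            ≡⟨ power-occurrence (suc m) p occ ⟩
    suc m * L               ≡⟨ length-rep (suc m) B ⟨
    length (rep (suc m) B)  ≡⟨ cong length (rep-suc-split m split) ⟩
    length (U′ ++ T)        ≡⟨ length-++ U′ ⟩
    length U′ + length T    ∎)

  next : FinInv m (rep (suc m) B ++ S) (T ++ S)
  next = record
    { U      = U′
    ; split  = next-split
    ; head   = nth-just-++ˡ (rep (suc m) B) S (nth-just-++ˡ B (rep m B) head)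
    ; above  = TS-above
    ; unique = λ p _ occ _ → next-unique p occ
    }

  uniqueSuffix : UniqueSuffix (fin (rep (suc m) B ++ S)) (fin (T ++ S))
  uniqueSuffix = U′ , (λ i → cong (λ Z → nth Z i) next-split) , next-unique

finInv : ∀ {m n B T} → Stage m n (fin B) (fin T) → FinInv m B T
finInv {m} base = record
  { U      = m ∷ []
  ; split  = refl
  ; head   = refl
  ; above  = []
  ; unique = λ p 1≤p _ fit → ≤-antisym (subst (_≤ 1) (+-identityʳ p) fit) 1≤p
  }
finInv (step-fin st glue) = FinStep.next (finInv st) glue

record PeriodicFrom (g : ℕ → ℕ) (a d : ℕ) : Set where
  constructor periodicFrom
  field repeats : ∀ j → g (a + (d + j)) ≡ g (a + j)
open PeriodicFrom

Aperiodic : (ℕ → ℕ) → Set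
Aperiodic g = ∀ a d → ¬ PeriodicFrom g a (suc d)

periodicFrom-shift : ∀ {g a d} e → PeriodicFrom g a d → PeriodicFrom g (e + a) d
periodicFrom-shift {g} {a} {d} e per = periodicFrom λ j → begin
  g (e + a + (d + j))   ≡⟨ cong g (trans (cong (_+ (d + j)) (+-comm e a)) (+-assoc a e (d + j))) ⟩
  g (a + (e + (d + j))) ≡⟨ cong (λ x → g (a + x)) (x∙yz≈y∙xz e d j) ⟩
  g (a + (d + (e + j))) ≡⟨ repeats per (e + j) ⟩
  g (a + (e + j))       ≡⟨ cong g (trans (sym (+-assoc a e j)) (cong (_+ j) (+-comm a e))) ⟩
  g (e + a + j)         ∎

periodicFrom-iterate : ∀ {g a d} → PeriodicFrom g a d → ∀ k → g (a + k * d) ≡ g a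
periodicFrom-iterate {g} {a} per zero    = cong g (+-identityʳ a)
periodicFrom-iterate {g} {a} per (suc k) = trans (repeats per _) (periodicFrom-iterate per k)

applyUpTo-cong : ∀ {f g : ℕ → ℕ} n → (∀ i → f i ≡ g i) → applyUpTo f n ≡ applyUpTo g n
applyUpTo-cong zero    f≗g = refl
applyUpTo-cong (suc n) f≗g = cong₂ _∷_ (f≗g 0) (applyUpTo-cong n (λ i → f≗g (suc i)))

applyUpTo-+ : ∀ (f : ℕ → ℕ) a b → applyUpTo f (a + b) ≡ applyUpTo f a ++ applyUpTo (λ i → f (a + i)) b
applyUpTo-+ f zero    b = refl
applyUpTo-+ f (suc a) b = cong (f 0 ∷_) (applyUpTo-+ (λ i → f (suc i)) a b)

applyUpTo-periodic : ∀ {g a d} → PeriodicFrom g a d → ∀ k →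
                     applyUpTo (λ i → g (a + i)) (k * d) ≡ rep k (applyUpTo (λ i → g (a + i)) d)
applyUpTo-periodic per zero = refl
applyUpTo-periodic {g} {a} {d} per (suc k) = begin
  applyUpTo h (d + k * d)
    ≡⟨ applyUpTo-+ h d (k * d) ⟩
  applyUpTo h d ++ applyUpTo (λ i → h (d + i)) (k * d)
    ≡⟨ cong (applyUpTo h d ++_) (applyUpTo-cong (k * d) (repeats per)) ⟩
  applyUpTo h d ++ applyUpTo h (k * d)
    ≡⟨ cong (applyUpTo h d ++_) (applyUpTo-periodic per k) ⟩
  applyUpTo h d ++ rep k (applyUpTo h d)
    ∎
  where
  h : ℕ → ℕ
  h i = g (a + i)

++ᶠ-length : ∀ U (s : ℕ → ℕ) i → (U ++ᶠ s) (length U + i) ≡ s i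
++ᶠ-length []      s i = refl
++ᶠ-length (x ∷ U) s i = ++ᶠ-length U s i

++ᶠ-assoc : ∀ X Y (s : ℕ → ℕ) i → ((X ++ Y) ++ᶠ s) i ≡ (X ++ᶠ (Y ++ᶠ s)) i
++ᶠ-assoc []      Y s i       = refl
++ᶠ-assoc (x ∷ X) Y s zero    = refl
++ᶠ-assoc (x ∷ X) Y s (suc i) = ++ᶠ-assoc X Y s i

periodicFrom-++ᶠ : ∀ U {s a d} → PeriodicFrom (U ++ᶠ s) a d → PeriodicFrom s a d
periodicFrom-++ᶠ U {s} {a} {d} per = periodicFrom λ j → begin
  s (a + (d + j))                      ≡⟨ ++ᶠ-length U s _ ⟨
  (U ++ᶠ s) (length U + (a + (d + j))) ≡⟨ cong (U ++ᶠ s) (+-assoc (length U) a _) ⟨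
  (U ++ᶠ s) (length U + a + (d + j))   ≡⟨ repeats (periodicFrom-shift (length U) per) j ⟩
  (U ++ᶠ s) (length U + a + j)         ≡⟨ cong (U ++ᶠ s) (+-assoc (length U) a j) ⟩
  (U ++ᶠ s) (length U + (a + j))       ≡⟨ ++ᶠ-length U s _ ⟩
  s (a + j)                            ∎

glue-aperiodic : ∀ {m B s} → IsSeq m B s → Aperiodic (rep (suc m) B ++ᶠ s)
glue-aperiodic {m} {B} {s} seq a d per =
  1+n≰n (subst (suc v ≤_) (periodicFrom-iterate perS (suc v)) (tail≤curlingᵐ (seq _) (s≤s z≤n) tail))
  where
  R : List ℕ
  R = rep (suc m) B
  perS : PeriodicFrom s a (suc d)
  perS = periodicFrom-++ᶠ R per
  v : ℕ
  v = s a
  Y : List ℕ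
  Y = applyUpTo (λ i → s (a + i)) (suc d)
  tail : HasTail (R ++ prefix s (a + suc v * suc d)) (suc v)
  tail = R ++ applyUpTo s a , Y , (λ ()) , (begin
    R ++ map s (upTo (a + suc v * suc d))
      ≡⟨ cong (R ++_) (map-upTo s _) ⟩
    R ++ applyUpTo s (a + suc v * suc d)
      ≡⟨ cong (R ++_) (applyUpTo-+ s a _) ⟩
    R ++ (applyUpTo s a ++ applyUpTo (λ i → s (a + i)) (suc v * suc d))
      ≡⟨ cong (λ Z → R ++ (applyUpTo s a ++ Z)) (applyUpTo-periodic perS (suc v)) ⟩
    R ++ (applyUpTo s a ++ rep (suc v) Y)
      ≡⟨ ++-assoc R (applyUpTo s a) _ ⟨
    (R ++ applyUpTo s a) ++ rep (suc v) Y
      ∎)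

offsets⇒periodicFrom : ∀ {g p q} → (∀ j → g (p + j) ≡ g (q + j)) → p < q →
                       Σ ℕ λ d → PeriodicFrom g p (suc d)
offsets⇒periodicFrom {g} {p} same p<q with m≤n⇒∃[o]m+o≡n p<q
... | d , refl = d , periodicFrom λ j →
  trans (cong g (trans (sym (+-assoc p (suc d) j)) (cong (_+ j) (+-suc p d)))) (sym (same j))

aperiodic-offset-unique : ∀ {g} → Aperiodic g → ∀ p q → (∀ j → g (p + j) ≡ g (q + j)) → p ≡ q
aperiodic-offset-unique {g} aper p q same with <-cmp p q
... | tri≈ _ p≡q _ = p≡q
... | tri< p<q _ _ with offsets⇒periodicFrom same p<q
...   | d , per = ⊥-elim (aper p d per)
aperiodic-offset-unique {g} aper p q same | tri> _ _ q<p with offsets⇒periodicFrom (λ j → sym (same j)) q<p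
...   | d , per = ⊥-elim (aper q d per)

record InfInv (b t : ℕ → ℕ) : Set where
  field
    U         : List ℕ
    suffix    : ∀ i → b i ≡ (U ++ᶠ t) i
    aperiodic : Aperiodic b

infInv : ∀ {m n b t} → Stage m n (inf b) (inf t) → InfInv b t
infInv (stay-inf st) = infInv st
infInv {m} (step-inf {B = B} {T = T} {s = s} st (seq , _)) = record
  { U         = rep m B ++ U
  ; suffix    = λ i → trans (cong (λ Z → (Z ++ᶠ s) i) (rep-suc-split m split))
                            (++ᶠ-assoc (rep m B ++ U) T s i)
  ; aperiodic = glue-aperiodic seq
  }
  where open FinInv (finInv st)

infInv-uniqueSuffix : ∀ {b t} → InfInv b t → UniqueSuffix (inf b) (inf t)
infInv-uniqueSuffix {b} {t} inv = U , (λ i → cong just (suffix i)) , unique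
  where
  open InfInv inv
  unique : ∀ p → OccursAt (inf t) (inf b) p → p ≡ length U
  unique p occ = aperiodic-offset-unique aperiodic p (length U)
    (λ j → trans (just-injective (occ j (t j) refl)) (sym (trans (suffix _) (++ᶠ-length U t j))))

lemma2 : (m n : ℕ) → 1 ≤ m → 2 ≤ n → (B T : Str) → Stage m n B T →
    Σ (List ℕ) λ U → (B ≈ˢ (U ++ˢ T)) × (∀ p → OccursAt T B p → p ≡ length U)
lemma2 m .1 _ (s≤s ()) _ _ base
lemma2 m _ _ _ _ _ (step-fin st glue) = FinStep.uniqueSuffix (finInv st) glue
lemma2 m _ _ _ (inf b) (inf t) st = infInv-uniqueSuffix (infInv st)
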